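{- Let $G\subseteq \mathsf{Labels}_D=\{\mathsf{enter},\mathsf{explain},\mathsf{thank},\mathsf{leave}\}$ be a set of actions each of which is globally inert for $\mathsf{Client}$ with respect to the partition $\mathsf{CS}$ (as defined in the context). Let $\mathsf{QClient}$ be the quotient STD of $\mathsf{Client}$ induced by $G$, and $\widehat{\mathsf{QClient}}$ its process algebraic translation (both as defined in the context). Then (i) $\mathsf{QClient}\ \underline{\leftrightarrow}_b\ \tau_G(\mathsf{Client})$, and (ii) $\partial_{H}\big(\widehat{\mathsf{QClient}}\parallel \widehat{\mathsf{Client}}(\mathsf{CS})\big)\ \underline{\leftrightarrow}_b\ \tau_{\mathsf{OK}(G)}\big(\widehat{\mathsf{Client}}(\mathsf{DG})\big)$, where $\mathsf{OK}(G)=\{\mathsf{ok}(a)\mid a\in G\}$.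
   Context: An STD is a triple $\langle \mathsf{ST},\mathsf{AC},\mathsf{TR}\rangle$ with $\mathsf{TR}\subseteq \mathsf{ST}\times\mathsf{AC}\times\mathsf{ST}$ (written $x\xrightarrow{a}x'$), with a designated initial state. The detailed STD $\mathsf{Client}$ has states $\mathsf{States}_D=\{\mathsf{Out},\mathsf{Waiting},\mathsf{Busy},\mathsf{AtDoor}\}$, initial state $\mathsf{Out}$, and transitions $\mathsf{Out}\xrightarrow{\mathsf{enter}}\mathsf{Waiting}\xrightarrow{\mathsf{explain}}\mathsf{Busy}\xrightarrow{\mathsf{thank}}\mathsf{AtDoor}\xrightarrow{\mathsf{leave}}\mathsf{Out}$. A phase of an STD is a sub-STD (subset of states, subset of actions, subset of transitions between those states with those actions). A trap of a phase is a nonempty set of its states closed under the phase's transitions. The partition $\mathsf{CS}$ of $\mathsf{Client}$ consists of three phases with trap sets: $\mathsf{Without}$ (states $\mathsf{Out},\mathsf{Waiting},\mathsf{AtDoor}$; transitions $\mathsf{enter},\mathsf{leave}$; traps $\mathsf{triv}$ = all its states); $\mathsf{Interrupt}$ (states $\mathsf{Out},\mathsf{Waiting},\mathsf{AtDoor}$; transition $\mathsf{leave}$ only; traps $\mathsf{triv}$ = all its states, $\mathsf{notYet}=\{\mathsf{Out},\mathsf{AtDoor}\}$, $\mathsf{request}=\{\mathsf{Waiting}\}$); $\mathsf{With}$ (states $\mathsf{Waiting},\mathsf{Busy},\mathsf{AtDoor}$; transitions $\mathsf{explain},\mathsf{thank}$; traps $\mathsf{triv}$ = all its states, $\mathsf{done}=\{\mathsf{AtDoor}\}$).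 A detailed transition $x\xrightarrow{a}x'$ is globally inert w.r.t. the partition $\{(S_i,T_i)\}$ if for every $i$ with $x,x'$ both states of $S_i$, and every trap $t\in T_i$, $x\in t\iff x'\in t$. An action is globally inert if all transitions labelled by it are. Process algebra (ACP with $\tau$): $\cdot$ sequential composition, $+$ choice, $\parallel$ parallel composition with communication function $|$, $\partial_J$ encapsulation (blocking actions in $J$), $\tau_I$ hiding (renaming actions in $I$ to $\tau$). Specification $\widehat{\mathsf{Client}}$ (initial $\mathsf{Out}$): $\mathsf{Out}=\mathsf{at}!(\mathsf{Out})\cdot\mathsf{Out}+\mathsf{ok}?(\mathsf{enter})\cdot\mathsf{Waiting}$; $\mathsf{Waiting}=\mathsf{at}!(\mathsf{Waiting})\cdot\mathsf{Waiting}+\mathsf{ok}?(\mathsf{explain})\cdot\mathsf{Busy}$; $\mathsf{Busy}=\mathsf{ok}?(\mathsf{thank})\cdot\mathsf{AtDoor}$; $\mathsf{AtDoor}=\mathsf{at}!(\mathsf{AtDoor})\cdot\mathsf{AtDoor}+\mathsf{ok}?(\mathsf{leave})\cdot\mathsf{Out}$. Specification $\widehat{\mathsf{Client}}(\mathsf{CS})$ (initial $\mathsf{Without}[\mathsf{triv}]$): $\mathsf{Without}[\mathsf{triv}]=\mathsf{ok}!(\mathsf{leave})\cdot\mathsf{Without}[\mathsf{triv}]+\mathsf{ok}!(\mathsf{enter})\cdot\mathsf{Without}[\mathsf{triv}]+\mathsf{trap}(\mathsf{triv})\cdot\mathsf{Interrupt}[\mathsf{triv}]$; $\mathsf{Interrupt}[\mathsf{triv}]=\mathsf{at}?(\mathsf{AtDoor})\cdot\mathsf{Interrupt}[\mathsf{notYet}]+\mathsf{at}?(\mathsf{Out})\cdot\mathsf{Interrupt}[\mathsf{notYet}]+\mathsf{at}?(\mathsf{Waiting})\cdot\mathsf{Interrupt}[\mathsf{request}]+\mathsf{ok}!(\mathsf{leave})\cdot\mathsf{Interrupt}[\mathsf{triv}]$;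 $\mathsf{Interrupt}[\mathsf{notYet}]=\mathsf{ok}!(\mathsf{leave})\cdot\mathsf{Interrupt}[\mathsf{notYet}]+\mathsf{trap}(\mathsf{notYet})\cdot\mathsf{Without}[\mathsf{triv}]$; $\mathsf{Interrupt}[\mathsf{request}]=\mathsf{trap}(\mathsf{request})\cdot\mathsf{With}[\mathsf{triv}]$; $\mathsf{With}[\mathsf{triv}]=\mathsf{at}?(\mathsf{AtDoor})\cdot\mathsf{With}[\mathsf{done}]+\mathsf{ok}!(\mathsf{explain})\cdot\mathsf{With}[\mathsf{triv}]+\mathsf{ok}!(\mathsf{thank})\cdot\mathsf{With}[\mathsf{triv}]$; $\mathsf{With}[\mathsf{done}]=\mathsf{trap}(\mathsf{done})\cdot\mathsf{Without}[\mathsf{triv}]$. Communication: $\mathsf{at}!(s)\,|\,\mathsf{at}?(s)=\tau$ for $s\in\{\mathsf{Out},\mathsf{Waiting},\mathsf{AtDoor}\}$, $\mathsf{ok}?(a)\,|\,\mathsf{ok}!(a)=\mathsf{ok}(a)$ for $a\in\mathsf{Labels}_D$; no other communications. $\mathsf{AT}=\{\mathsf{at}!(s),\mathsf{at}?(s)\mid s\in\mathsf{States}_D\}$, $\mathsf{OK}=\{\mathsf{ok}!(a),\mathsf{ok}?(a)\mid a\in\mathsf{Labels}_D\}$, $H=\mathsf{AT}\cup\mathsf{OK}$, and $\widehat{\mathsf{Client}}(\mathsf{DG})=\partial_H(\widehat{\mathsf{Client}}\parallel\widehat{\mathsf{Client}}(\mathsf{CS}))$. Quotient: let $\sim$ be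 the equivalence on $\mathsf{States}_D$ generated by $x\sim x'$ whenever $x\xrightarrow{a}x'$ with $a\in G$. $\mathsf{QClient}$ is the STD whose states are the $\sim$-classes, initial state the class of $\mathsf{Out}$, with a transition $[x]\xrightarrow{a}[x']$ for each transition $x\xrightarrow{a}x'$ of $\mathsf{Client}$ with $a\notin G$. Its translation $\widehat{\mathsf{QClient}}$ has, for each class $C$, the equation $C=\mathsf{at}!(C)\cdot C+\sum_{C\xrightarrow{a}C'}\mathsf{ok}?(a)\cdot C'$; the communication function is extended by $\mathsf{at}!(C)\,|\,\mathsf{at}?(s)=\tau$ for $s\in C$, and $\mathsf{AT}$ (hence $H$) is extended with the actions $\mathsf{at}!(C)$. Branching bisimulation: a symmetric relation $R$ between states of two STDs such that if $R(s,t)$ and $s\xrightarrow{a}s'$, then either $a=\tau$ and $R(s',t)$, or there are $t\xrightarrow{\tau}t_1\cdots\xrightarrow{\tau}t_n\xrightarrow{a}t'$ ($n\ge0$) with $R(s,t_j)$ for all $j$ and $R(s',t')$. Two STDs are branching bisimilar ($\underline{\leftrightarrow}_b$) if their initial states are related by some branching bisimulation. -}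

module Defs where

open import Data.Bool using (Bool; true; false; T)
open import Data.Product using (Σ; ∃; ∃-syntax; _×_; _,_)
open import Data.Sum using (_⊎_; inj₁; inj₂)
open import Relation.Nullary using (¬_)
open import Data.Empty using (⊥)
open import Data.Unit using (⊤)
open import Relation.Binary.PropositionalEquality using (_≡_; _≢_)

Steps : Set → Set → Set₁
Steps S A = S → A → S → Set

data TauPath {S A : Set} (τ : A) (step : Steps S A) (P : S → Set) : S → S → Set where
  done : ∀ {t} → TauPath τ step P t t
  more : ∀ {t t₁ u} → step t τ t₁ → P t₁ → TauPath τ step P t₁ u → TauPath τ step P t u

Transfer : {A S T : Set} (τ : A) → Steps S A → Steps T A → (S → T → Set) → Set
Transfer {A} {S} {T} τ stepS stepT R =
  ∀ {s t s' a} → R s t → stepS s a s' →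
    (a ≡ τ × R s' t)
    ⊎ (Σ T λ u → Σ T λ t' →
         TauPath τ stepT (R s) t u × stepT u a t' × R s' t')

IsBranchingBisim : {A S T : Set} (τ : A) → Steps S A → Steps T A → (S → T → Set) → Set
IsBranchingBisim τ stepS stepT R =
  Transfer τ stepS stepT R × Transfer τ stepT stepS (λ t s → R s t)

BranchingBisimilar : {A S T : Set} (τ : A) → Steps S A → S → Steps T A → T → Set₁
BranchingBisimilar {A} {S} {T} τ stepS s₀ stepT t₀ =
  Σ (S → T → Set) λ R → IsBranchingBisim τ stepS stepT R × R s₀ t₀

data StateD : Set where
  Out Waiting Busy AtDoor : StateD

data Label : Set where
  enter explain thank leave : Label

data ClientStep : StateD → Label → StateD → Set where
  s-enter   : ClientStep Out enter Waiting
  s-explain : ClientStep Waiting explain Busy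
  s-thank   : ClientStep Busy thank AtDoor
  s-leave   : ClientStep AtDoor leave Out

data Phase : Set where
  Without Interrupt With : Phase

inPhase : Phase → StateD → Bool
inPhase Without   Busy = false
inPhase Without   _    = true
inPhase Interrupt Busy = false
inPhase Interrupt _    = true
inPhase With      Out  = false
inPhase With      _    = true

data PhaseStep : Phase → StateD → Label → StateD → Set where
  w-enter   : PhaseStep Without Out enter Waiting
  w-leave   : PhaseStep Without AtDoor leave Out
  i-leave   : PhaseStep Interrupt AtDoor leave Out
  h-explain : PhaseStep With Waiting explain Busy
  h-thank   : PhaseStep With Busy thank AtDoor

data TrapName : Set where
  triv notYet request done : TrapName

isTrap : Phase → TrapName → Bool
isTrap _         triv    = true
isTrap Interrupt notYet  = true
isTrap Interrupt request = true
isTrap With      done    = true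
isTrap _         _       = false

inTrap : Phase → TrapName → StateD → Bool
inTrap p triv x = inPhase p x
inTrap Interrupt notYet Out    = true
inTrap Interrupt notYet AtDoor = true
inTrap Interrupt request Waiting = true
inTrap With done AtDoor = true
inTrap _ _ _ = false

GloballyInertTr : StateD → Label → StateD → Set
GloballyInertTr x a x' =
  ∀ (i : Phase) → T (inPhase i x) → T (inPhase i x') →
  ∀ (t : TrapName) → T (isTrap i t) →
  (T (inTrap i t x) → T (inTrap i t x')) × (T (inTrap i t x') → T (inTrap i t x))

GloballyInert : Label → Set
GloballyInert a = ∀ x x' → ClientStep x a x' → GloballyInertTr x a x'

data _∼[_]_ : StateD → (Label → Bool) → StateD → Set where
  ∼-step  : ∀ {G x a x'} → ClientStep x a x' → T (G a) → x ∼[ G ] x'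
  ∼-refl  : ∀ {G x} → x ∼[ G ] x
  ∼-sym   : ∀ {G x y} → x ∼[ G ] y → y ∼[ G ] x
  ∼-trans : ∀ {G x y z} → x ∼[ G ] y → y ∼[ G ] z → x ∼[ G ] z

-- QClient, with each ∼-class represented by any of its members (setoid
-- presentation of the quotient): [x] -a-> [x'] for x -a-> x' with a ∉ G.
QClientStep : (Label → Bool) → Steps StateD Label
QClientStep G y a y' =
  ¬ T (G a) × Σ StateD λ x → Σ StateD λ x' →
    x ∼[ G ] y × x' ∼[ G ] y' × ClientStep x a x'

data LAct : Set where
  lab : Label → LAct
  τL  : LAct

HideClientStep : (Label → Bool) → Steps StateD LAct
HideClientStep G x (lab a) x' = ClientStep x a x' × ¬ T (G a)
HideClientStep G x τL x' = Σ Label λ a → ClientStep x a x' × T (G a)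

QClientLStep : (Label → Bool) → Steps StateD LAct
QClientLStep G x (lab a) x' = QClientStep G x a x'
QClientLStep G x τL x' = ⊥

data PAct : Set where
  at!  : StateD → PAct
  atQ! : StateD → PAct          -- at!(C), sent by QClient; C given by a representative
  at?  : StateD → PAct
  ok?  : Label → PAct
  ok!  : Label → PAct
  ok   : Label → PAct
  trap : TrapName → PAct
  τ    : PAct

data Comm (G : Label → Bool) : PAct → PAct → PAct → Set where
  c-at   : ∀ {s} → s ≢ Busy → Comm G (at! s) (at? s) τ
  c-atQ  : ∀ {x s} → x ∼[ G ] s → Comm G (atQ! x) (at? s) τ
  c-ok   : ∀ {a} → Comm G (ok? a) (ok! a) (ok a)
  c-sym  : ∀ {a b c} → Comm G a b c → Comm G b a c

data Par {P Q A : Set} (comm : A → A → A → Set) (stepP : Steps P A) (stepQ : Steps Q A)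
         : Steps (P × Q) A where
  par-l : ∀ {p p' q a} → stepP p a p' → Par comm stepP stepQ (p , q) a (p' , q)
  par-r : ∀ {p q q' a} → stepQ q a q' → Par comm stepP stepQ (p , q) a (p , q')
  par-c : ∀ {p p' q q' a b c} → stepP p a p' → stepQ q b q' → comm a b c →
          Par comm stepP stepQ (p , q) c (p' , q')

Encap : {S A : Set} → (A → Set) → Steps S A → Steps S A
Encap J step s a s' = step s a s' × ¬ J a

Hide : {S : Set} → (PAct → Set) → Steps S PAct → Steps S PAct
Hide I step s b s' = Σ PAct λ a → step s a s' × ((I a × b ≡ τ) ⊎ (¬ I a × b ≡ a))

-- H = AT ∪ OK (AT extended with the actions at!(C))
InH : PAct → Set
InH (at! _)  = ⊤
InH (atQ! _) = ⊤
InH (at? _)  = ⊤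
InH (ok? _)  = ⊤
InH (ok! _)  = ⊤
InH _        = ⊥

InOKG : (Label → Bool) → PAct → Set
InOKG G (ok a) = T (G a)
InOKG G _      = ⊥

data ClientP : Steps StateD PAct where
  out-at    : ClientP Out (at! Out) Out
  out-ok    : ClientP Out (ok? enter) Waiting
  wait-at   : ClientP Waiting (at! Waiting) Waiting
  wait-ok   : ClientP Waiting (ok? explain) Busy
  busy-ok   : ClientP Busy (ok? thank) AtDoor
  door-at   : ClientP AtDoor (at! AtDoor) AtDoor
  door-ok   : ClientP AtDoor (ok? leave) Out

data CSState : Set where
  Without[triv] Interrupt[triv] Interrupt[notYet] Interrupt[request] With[triv] With[done] : CSState

data ClientCSP : Steps CSState PAct where
  wt-leave  : ClientCSP Without[triv] (ok! leave) Without[triv]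
  wt-enter  : ClientCSP Without[triv] (ok! enter) Without[triv]
  wt-trap   : ClientCSP Without[triv] (trap triv) Interrupt[triv]
  it-door   : ClientCSP Interrupt[triv] (at? AtDoor) Interrupt[notYet]
  it-out    : ClientCSP Interrupt[triv] (at? Out) Interrupt[notYet]
  it-wait   : ClientCSP Interrupt[triv] (at? Waiting) Interrupt[request]
  it-leave  : ClientCSP Interrupt[triv] (ok! leave) Interrupt[triv]
  in-leave  : ClientCSP Interrupt[notYet] (ok! leave) Interrupt[notYet]
  in-trap   : ClientCSP Interrupt[notYet] (trap notYet) Without[triv]
  ir-trap   : ClientCSP Interrupt[request] (trap request) With[triv]
  ht-door   : ClientCSP With[triv] (at? AtDoor) With[done]
  ht-explain : ClientCSP With[triv] (ok! explain) With[triv]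
  ht-thank  : ClientCSP With[triv] (ok! thank) With[triv]
  hd-trap   : ClientCSP With[done] (trap done) Without[triv]

-- \hat{QClient}: C = at!(C)·C + Σ_{C -a-> C'} ok?(a)·C'   (classes by representatives)
data QClientP (G : Label → Bool) : Steps StateD PAct where
  q-at : ∀ {x} → QClientP G x (atQ! x) x
  q-ok : ∀ {x a y} → QClientStep G x a y → QClientP G x (ok? a) y

ClientDG : (Label → Bool) → Steps (StateD × CSState) PAct
ClientDG G = Encap InH (Par (Comm G) ClientP ClientCSP)

QClientDG : (Label → Bool) → Steps (StateD × CSState) PAct
QClientDG G = Encap InH (Par (Comm G) (QClientP G) ClientCSP)

-- Global inertness rules out hiding enter (it leaves the trap notYet of Interrupt) and thank
-- (it enters the trap done of With), and everything in the statement depends on G only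
-- pointwise, so G may be taken to hide at most explain and leave. The ∼-classes are then
-- Waiting–Busy, AtDoor–Out or singletons, each a path of hidden steps ending in its sink, the
-- only state with visible steps. So τ_G(Client) can silently walk to the sink and copy any
-- step of QClient, and "same class" is a branching bisimulation. For the compositions the same
-- relation, with equal CS states and restricted to reachable states, works: a CS state
-- offering the exit action of a class also offers the hidden actions leading to it, and the
-- at?-moves of CS never distinguish states of one class.

module Submission where

open import Defs
open import Data.Bool using (Bool; T; true; false)
open import Data.Empty using (⊥-elim)
open import Data.Product using (∃-syntax; _×_; _,_; proj₁; proj₂)
open import Data.Sum as Sum using (_⊎_; inj₁; inj₂)
open import Data.Unit using (tt)
open import Level using (0ℓ)
open import Relation.Binary using (Rel)
open import Relation.Binary.Construct.Closure.ReflexiveTransitive using (Star; ε; _◅_)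
open import Relation.Binary.PropositionalEquality
  using (_≡_; _≢_; _≗_; refl; sym; trans; subst; cong; module ≡-Reasoning)
open import Relation.Nullary using (¬_)

_⊆ˢ_ : {S A : Set} → Steps S A → Steps S A → Set
step ⊆ˢ step' = ∀ {s a s'} → step s a s' → step' s a s'

module _ {S A : Set} {τ : A} where

  TauPath-map : {step step' : Steps S A} {P : S → Set} → step ⊆ˢ step' →
    ∀ {t u} → TauPath τ step P t u → TauPath τ step' P t u
  TauPath-map f done = done
  TauPath-map f (more st p path) = more (f st) p (TauPath-map f path)

  TauPath-end : {step : Steps S A} {P : S → Set} {t u : S} → TauPath τ step P t u → P t → P u
  TauPath-end done p = p
  TauPath-end (more _ p path) _ = TauPath-end path p

  Star⇒TauPath : {step : Steps S A} {P : S → Set} {_⇝_ : Rel S 0ℓ} →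
    (∀ {s s'} → s ⇝ s' → step s τ s') → (∀ {s s'} → s ⇝ s' → P s → P s') →
    ∀ {t u} → P t → Star _⇝_ t u → TauPath τ step P t u
  Star⇒TauPath emb pres p ε = done
  Star⇒TauPath emb pres p (s ◅ ss) =
    more (emb s) (pres s p) (Star⇒TauPath emb pres (pres s p) ss)

Transfer-resp : {A S T : Set} {τ : A} {stepS stepS' : Steps S A} {stepT stepT' : Steps T A}
  {R : S → T → Set} → stepS' ⊆ˢ stepS → stepT ⊆ˢ stepT' →
  Transfer τ stepS stepT R → Transfer τ stepS' stepT' R
Transfer-resp S'⊆S T⊆T' tr r st with tr r (S'⊆S st)
... | inj₁ τ-stutter = inj₁ τ-stutter
... | inj₂ (u , t' , path , st' , r') = inj₂ (u , t' , TauPath-map T⊆T' path , T⊆T' st' , r')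

BranchingBisimilar-resp : {A S T : Set} {τ : A} {stepS stepS' : Steps S A}
  {stepT stepT' : Steps T A} {s₀ : S} {t₀ : T} →
  stepS ⊆ˢ stepS' → stepS' ⊆ˢ stepS → stepT ⊆ˢ stepT' → stepT' ⊆ˢ stepT →
  BranchingBisimilar τ stepS s₀ stepT t₀ → BranchingBisimilar τ stepS' s₀ stepT' t₀
BranchingBisimilar-resp {stepS = stepS} {stepT = stepT} S⊆S' S'⊆S T⊆T' T'⊆T (R , (tr , tr⁻) , r₀) =
  R , (Transfer-resp {stepS = stepS} S'⊆S T⊆T' tr , Transfer-resp {stepS = stepT} T'⊆T S⊆S' tr⁻) , r₀

Par-map : {P Q A : Set} {comm comm' : A → A → A → Set}
  {stepP stepP' : Steps P A} {stepQ stepQ' : Steps Q A} →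
  (∀ {a b c} → comm a b c → comm' a b c) → stepP ⊆ˢ stepP' → stepQ ⊆ˢ stepQ' →
  Par comm stepP stepQ ⊆ˢ Par comm' stepP' stepQ'
Par-map fc fp fq (par-l p) = par-l (fp p)
Par-map fc fp fq (par-r q) = par-r (fq q)
Par-map fc fp fq (par-c p q c) = par-c (fp p) (fq q) (fc c)

Hide-map : {S : Set} {I I' : PAct → Set} {step step' : Steps S PAct} →
  (∀ {a} → I a → I' a) → (∀ {a} → I' a → I a) → step ⊆ˢ step' → Hide I step ⊆ˢ Hide I' step'
Hide-map I⇒I' I'⇒I f (a , st , inj₁ (i , b≡τ)) = a , f st , inj₁ (I⇒I' i , b≡τ)
Hide-map I⇒I' I'⇒I f (a , st , inj₂ (¬i , b≡a)) = a , f st , inj₂ ((λ i → ¬i (I'⇒I i)) , b≡a)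

InOKG-mono : (G G' : Label → Bool) → (∀ a → T (G a) → T (G' a)) →
  ∀ {b} → InOKG G b → InOKG G' b
InOKG-mono _ _ f {ok a} = f a
InOKG-mono _ _ f {at! _} ()
InOKG-mono _ _ f {atQ! _} ()
InOKG-mono _ _ f {at? _} ()
InOKG-mono _ _ f {ok? _} ()
InOKG-mono _ _ f {ok! _} ()
InOKG-mono _ _ f {trap _} ()
InOKG-mono _ _ f {τ} ()

module Resp {G G' : Label → Bool} (G≗G' : G ≗ G') where

  ⇒G' : ∀ {a} → T (G a) → T (G' a)
  ⇒G' {a} = subst T (G≗G' a)

  ⇒G : ∀ {a} → T (G' a) → T (G a)
  ⇒G {a} = subst T (sym (G≗G' a))

  ∼-resp : ∀ {x y} → x ∼[ G ] y → x ∼[ G' ] y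
  ∼-resp (∼-step st g) = ∼-step st (⇒G' g)
  ∼-resp ∼-refl = ∼-refl
  ∼-resp (∼-sym p) = ∼-sym (∼-resp p)
  ∼-resp (∼-trans p q) = ∼-trans (∼-resp p) (∼-resp q)

  QClientStep-resp : QClientStep G ⊆ˢ QClientStep G'
  QClientStep-resp (¬g , x , x' , x∼y , x'∼y' , st) =
    (λ g → ¬g (⇒G g)) , x , x' , ∼-resp x∼y , ∼-resp x'∼y' , st

  QClientLStep-resp : QClientLStep G ⊆ˢ QClientLStep G'
  QClientLStep-resp {a = lab _} = QClientStep-resp
  QClientLStep-resp {a = τL} ()

  HideClientStep-resp : HideClientStep G ⊆ˢ HideClientStep G'
  HideClientStep-resp {a = lab _} (st , ¬g) = st , (λ g → ¬g (⇒G g))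
  HideClientStep-resp {a = τL} (l , st , g) = l , st , ⇒G' g

  Comm-resp : ∀ {a b c} → Comm G a b c → Comm G' a b c
  Comm-resp (c-at ne) = c-at ne
  Comm-resp (c-atQ x∼s) = c-atQ (∼-resp x∼s)
  Comm-resp c-ok = c-ok
  Comm-resp (c-sym p) = c-sym (Comm-resp p)

  QClientP-resp : QClientP G ⊆ˢ QClientP G'
  QClientP-resp q-at = q-at
  QClientP-resp (q-ok st) = q-ok (QClientStep-resp st)

  QClientDG-resp : QClientDG G ⊆ˢ QClientDG G'
  QClientDG-resp (st , ¬h) = Par-map Comm-resp QClientP-resp (λ q → q) st , ¬h

  HiddenDG-resp : Hide (InOKG G) (ClientDG G) ⊆ˢ Hide (InOKG G') (ClientDG G')
  HiddenDG-resp = Hide-map {I = InOKG G} {step = ClientDG G}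
    (λ {b} → InOKG-mono G G' (λ _ → ⇒G') {b}) (λ {b} → InOKG-mono G' G (λ _ → ⇒G) {b})
    (λ (st , ¬h) → Par-map Comm-resp (λ p → p) (λ q → q) st , ¬h)

QuotientVsHiding : (Label → Bool) → Set₁
QuotientVsHiding G = BranchingBisimilar τL (QClientLStep G) Out (HideClientStep G) Out

ComposedVsHiding : (Label → Bool) → Set₁
ComposedVsHiding G = BranchingBisimilar τ (QClientDG G) (Out , Without[triv])
  (Hide (InOKG G) (ClientDG G)) (Out , Without[triv])

module _ {G G' : Label → Bool} (G≗G' : G ≗ G') where
  private
    module To = Resp G≗G'
    module From = Resp (λ a → sym (G≗G' a))

  QuotientVsHiding-resp : QuotientVsHiding G → QuotientVsHiding G'
  QuotientVsHiding-resp = BranchingBisimilar-resp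
    To.QClientLStep-resp From.QClientLStep-resp To.HideClientStep-resp From.HideClientStep-resp

  ComposedVsHiding-resp : ComposedVsHiding G → ComposedVsHiding G'
  ComposedVsHiding-resp = BranchingBisimilar-resp
    To.QClientDG-resp From.QClientDG-resp To.HiddenDG-resp From.HiddenDG-resp

¬GloballyInert-enter : ¬ GloballyInert enter
¬GloballyInert-enter inert = proj₁ (inert Out Waiting s-enter Interrupt tt tt notYet tt) tt

¬GloballyInert-thank : ¬ GloballyInert thank
¬GloballyInert-thank inert = proj₂ (inert Busy AtDoor s-thank With tt tt done tt) tt

G[_,_] : Bool → Bool → Label → Bool
G[ b₁ , b₂ ] enter = false
G[ b₁ , b₂ ] explain = b₁
G[ b₁ , b₂ ] thank = false
G[ b₁ , b₂ ] leave = b₂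

¬T⇒≡false : ∀ {b} → ¬ T b → b ≡ false
¬T⇒≡false {false} _ = refl
¬T⇒≡false {true} ¬t = ⊥-elim (¬t tt)

G[explain,leave]≗ : (G : Label → Bool) → (∀ a → T (G a) → GloballyInert a) →
  G[ G explain , G leave ] ≗ G
G[explain,leave]≗ G inert enter = sym (¬T⇒≡false (λ g → ¬GloballyInert-enter (inert enter g)))
G[explain,leave]≗ G inert explain = refl
G[explain,leave]≗ G inert thank = sym (¬T⇒≡false (λ g → ¬GloballyInert-thank (inert thank g)))
G[explain,leave]≗ G inert leave = refl

GStep : (Label → Bool) → Rel StateD 0ℓ
GStep G x x' = HideClientStep G x τL x'

Star⇒∼ : ∀ {G x y} → Star (GStep G) x y → x ∼[ G ] y
Star⇒∼ ε = ∼-refl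
Star⇒∼ ((_ , st , g) ◅ path) = ∼-trans (∼-step st g) (Star⇒∼ path)

-- Each class is represented by its last state, the only one with non-G steps.
sink : Bool → Bool → StateD → StateD
sink b₁ b₂ Out = Out
sink true b₂ Waiting = Busy
sink false b₂ Waiting = Waiting
sink b₁ b₂ Busy = Busy
sink b₁ true AtDoor = Out
sink b₁ false AtDoor = AtDoor

to-sink : ∀ b₁ b₂ x → Star (GStep G[ b₁ , b₂ ]) x (sink b₁ b₂ x)
to-sink b₁ b₂ Out = ε
to-sink true b₂ Waiting = (explain , s-explain , tt) ◅ ε
to-sink false b₂ Waiting = ε
to-sink b₁ b₂ Busy = ε
to-sink b₁ true AtDoor = (leave , s-leave , tt) ◅ ε
to-sink b₁ false AtDoor = ε

GStep-sink : ∀ b₁ b₂ {x x'} → GStep G[ b₁ , b₂ ] x x' → sink b₁ b₂ x ≡ sink b₁ b₂ x'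
GStep-sink b₁ b₂ (enter , s-enter , ())
GStep-sink true b₂ (explain , s-explain , _) = refl
GStep-sink false b₂ (explain , s-explain , ())
GStep-sink b₁ b₂ (thank , s-thank , ())
GStep-sink b₁ true (leave , s-leave , _) = refl
GStep-sink b₁ false (leave , s-leave , ())

sink-exit : ∀ b₁ b₂ {x a x'} → ClientStep x a x' → ¬ T (G[ b₁ , b₂ ] a) → sink b₁ b₂ x ≡ x
sink-exit b₁ b₂ s-enter _ = refl
sink-exit true b₂ s-explain ¬g = ⊥-elim (¬g tt)
sink-exit false b₂ s-explain _ = refl
sink-exit b₁ b₂ s-thank _ = refl
sink-exit b₁ true s-leave ¬g = ⊥-elim (¬g tt)
sink-exit b₁ false s-leave _ = refl

data Reachable : StateD → CSState → Set where
  Without-Out       : Reachable Out Without[triv]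
  Without-Waiting   : Reachable Waiting Without[triv]
  Without-AtDoor    : Reachable AtDoor Without[triv]
  Interrupt-Out     : Reachable Out Interrupt[triv]
  Interrupt-Waiting : Reachable Waiting Interrupt[triv]
  Interrupt-AtDoor  : Reachable AtDoor Interrupt[triv]
  notYet-Out        : Reachable Out Interrupt[notYet]
  notYet-AtDoor     : Reachable AtDoor Interrupt[notYet]
  request-Waiting   : Reachable Waiting Interrupt[request]
  With-Waiting      : Reachable Waiting With[triv]
  With-Busy         : Reachable Busy With[triv]
  With-AtDoor       : Reachable AtDoor With[triv]
  done-AtDoor       : Reachable AtDoor With[done]

Reachable-trap : ∀ {c t c' x} → ClientCSP c (trap t) c' → Reachable x c → Reachable x c'
Reachable-trap wt-trap Without-Out = Interrupt-Out
Reachable-trap wt-trap Without-Waiting = Interrupt-Waiting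
Reachable-trap wt-trap Without-AtDoor = Interrupt-AtDoor
Reachable-trap in-trap notYet-Out = Without-Out
Reachable-trap in-trap notYet-AtDoor = Without-AtDoor
Reachable-trap ir-trap request-Waiting = With-Waiting
Reachable-trap hd-trap done-AtDoor = Without-AtDoor

Reachable-at : ∀ {c x c'} → ClientCSP c (at? x) c' → Reachable x c → Reachable x c'
Reachable-at it-door Interrupt-AtDoor = notYet-AtDoor
Reachable-at it-out Interrupt-Out = notYet-Out
Reachable-at it-wait Interrupt-Waiting = request-Waiting
Reachable-at ht-door With-AtDoor = done-AtDoor

Reachable-ok : ∀ {c a c' x x'} → ClientCSP c (ok! a) c' → ClientStep x a x' →
  Reachable x c → Reachable x' c'
Reachable-ok wt-leave s-leave Without-AtDoor = Without-Out
Reachable-ok wt-enter s-enter Without-Out = Without-Waiting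
Reachable-ok it-leave s-leave Interrupt-AtDoor = Interrupt-Out
Reachable-ok in-leave s-leave notYet-AtDoor = notYet-Out
Reachable-ok ht-explain s-explain With-Waiting = With-Busy
Reachable-ok ht-thank s-thank With-Busy = With-AtDoor

ClientP-in-H : ∀ {x a x'} → ClientP x a x' → InH a
ClientP-in-H out-at = tt
ClientP-in-H out-ok = tt
ClientP-in-H wait-at = tt
ClientP-in-H wait-ok = tt
ClientP-in-H busy-ok = tt
ClientP-in-H door-at = tt
ClientP-in-H door-ok = tt

QClientP-in-H : ∀ {G x a x'} → QClientP G x a x' → InH a
QClientP-in-H q-at = tt
QClientP-in-H (q-ok _) = tt

ClientP-ok⇒ClientStep : ∀ {x a x'} → ClientP x (ok? a) x' → ClientStep x a x'
ClientP-ok⇒ClientStep out-ok = s-enter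
ClientP-ok⇒ClientStep wait-ok = s-explain
ClientP-ok⇒ClientStep busy-ok = s-thank
ClientP-ok⇒ClientStep door-ok = s-leave

ClientStep⇒ClientP-ok : ∀ {x a x'} → ClientStep x a x' → ClientP x (ok? a) x'
ClientStep⇒ClientP-ok s-enter = out-ok
ClientStep⇒ClientP-ok s-explain = wait-ok
ClientStep⇒ClientP-ok s-thank = busy-ok
ClientStep⇒ClientP-ok s-leave = door-ok

ClientP-at-loop : ∀ {x s x'} → ClientP x (at! s) x' → s ≡ x × x' ≡ x
ClientP-at-loop out-at = refl , refl
ClientP-at-loop wait-at = refl , refl
ClientP-at-loop door-at = refl , refl

ClientP-at : ∀ {s} → s ≢ Busy → ClientP s (at! s) s
ClientP-at {Out} _ = out-at
ClientP-at {Waiting} _ = wait-at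
ClientP-at {Busy} s≢Busy = ⊥-elim (s≢Busy refl)
ClientP-at {AtDoor} _ = door-at

ClientCSP-at?-≢Busy : ∀ {c s c'} → ClientCSP c (at? s) c' → s ≢ Busy
ClientCSP-at?-≢Busy it-door ()
ClientCSP-at?-≢Busy it-out ()
ClientCSP-at?-≢Busy it-wait ()
ClientCSP-at?-≢Busy ht-door ()

ClientCSP-ok!-loop : ∀ {c a c'} → ClientCSP c (ok! a) c' → c' ≡ c
ClientCSP-ok!-loop wt-leave = refl
ClientCSP-ok!-loop wt-enter = refl
ClientCSP-ok!-loop it-leave = refl
ClientCSP-ok!-loop in-leave = refl
ClientCSP-ok!-loop ht-explain = refl
ClientCSP-ok!-loop ht-thank = refl

ClientCSP-¬H⇒trap : ∀ {c a c'} → ClientCSP c a c' → ¬ InH a → ∃[ t ] a ≡ trap t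
ClientCSP-¬H⇒trap wt-trap _ = triv , refl
ClientCSP-¬H⇒trap in-trap _ = notYet , refl
ClientCSP-¬H⇒trap ir-trap _ = request , refl
ClientCSP-¬H⇒trap hd-trap _ = done , refl
ClientCSP-¬H⇒trap wt-leave ¬h = ⊥-elim (¬h tt)
ClientCSP-¬H⇒trap wt-enter ¬h = ⊥-elim (¬h tt)
ClientCSP-¬H⇒trap it-door ¬h = ⊥-elim (¬h tt)
ClientCSP-¬H⇒trap it-out ¬h = ⊥-elim (¬h tt)
ClientCSP-¬H⇒trap it-wait ¬h = ⊥-elim (¬h tt)
ClientCSP-¬H⇒trap it-leave ¬h = ⊥-elim (¬h tt)
ClientCSP-¬H⇒trap in-leave ¬h = ⊥-elim (¬h tt)
ClientCSP-¬H⇒trap ht-door ¬h = ⊥-elim (¬h tt)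
ClientCSP-¬H⇒trap ht-explain ¬h = ⊥-elim (¬h tt)
ClientCSP-¬H⇒trap ht-thank ¬h = ⊥-elim (¬h tt)

data OrientedComm (G : Label → Bool) : PAct → PAct → PAct → Set where
  o-at  : ∀ {s} → s ≢ Busy → OrientedComm G (at! s) (at? s) τ
  o-atQ : ∀ {x s} → x ∼[ G ] s → OrientedComm G (atQ! x) (at? s) τ
  o-ok  : ∀ {a} → OrientedComm G (ok? a) (ok! a) (ok a)

orient : ∀ {G a b c} → Comm G a b c → OrientedComm G a b c ⊎ OrientedComm G b a c
orient (c-at s≢Busy) = inj₁ (o-at s≢Busy)
orient (c-atQ x∼s) = inj₁ (o-atQ x∼s)
orient c-ok = inj₁ o-ok
orient (c-sym p) = Sum.swap (orient p)

DG-ok : ∀ {G x a x' c c'} → ClientStep x a x' → ClientCSP c (ok! a) c' →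
  ClientDG G (x , c) (ok a) (x' , c')
DG-ok st q = par-c (ClientStep⇒ClientP-ok st) q c-ok , (λ ())

DG-at : ∀ {G x c c'} → ClientCSP c (at? x) c' → ClientDG G (x , c) τ (x , c')
DG-at {x = x} q = par-c (ClientP-at x≢Busy) q (c-at x≢Busy) , (λ ())
  where
  x≢Busy : x ≢ Busy
  x≢Busy = ClientCSP-at?-≢Busy q

QDG-ok : ∀ {G y a y' c c'} → QClientStep G y a y' → ClientCSP c (ok! a) c' →
  QClientDG G (y , c) (ok a) (y' , c')
QDG-ok st q = par-c (q-ok st) q c-ok , (λ ())

QDG-at : ∀ {G y s c c'} → y ∼[ G ] s → ClientCSP c (at? s) c' → QClientDG G (y , c) τ (y , c')
QDG-at y∼s q = par-c q-at q (c-atQ y∼s) , (λ ())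

data HiddenSync (G : Label → Bool) : Rel (StateD × CSState) 0ℓ where
  sync : ∀ {x g x' c} → ClientStep x g x' → T (G g) → ClientCSP c (ok! g) c →
    HiddenSync G (x , c) (x' , c)

HiddenSync⇒τ : ∀ {G p p'} → HiddenSync G p p' → Hide (InOKG G) (ClientDG G) p τ p'
HiddenSync⇒τ (sync st g q) = _ , DG-ok st q , inj₁ (g , refl)

-- Where CS offers the exit action of a class, it also offers the hidden actions leading to it.
offers-GStep : ∀ {b₁ b₂ x g z x₀ a x₀' c c'} → ClientStep x g z → T (G[ b₁ , b₂ ] g) →
  Star (GStep G[ b₁ , b₂ ]) z x₀ → ClientStep x₀ a x₀' → ClientCSP c (ok! a) c' →
  ClientCSP c (ok! g) c
offers-GStep s-enter () _ _ _
offers-GStep s-thank () _ _ _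
offers-GStep s-explain _ ε s-thank ht-thank = ht-explain
offers-GStep s-explain _ ((_ , s-thank , ()) ◅ _) _ _
offers-GStep s-leave _ ε s-enter wt-enter = wt-leave
offers-GStep s-leave _ ((_ , s-enter , ()) ◅ _) _ _

lift-to-exit : ∀ b₁ b₂ {x x₀ a x₀' c c'} → Star (GStep G[ b₁ , b₂ ]) x x₀ →
  ClientStep x₀ a x₀' → ClientCSP c (ok! a) c' → Star (HiddenSync G[ b₁ , b₂ ]) (x , c) (x₀ , c)
lift-to-exit b₁ b₂ ε _ _ = ε
lift-to-exit b₁ b₂ ((_ , st , g) ◅ path) exit q =
  sync st g (offers-GStep {b₁} {b₂} st g path exit q) ◅ lift-to-exit b₁ b₂ path exit q

engaged : StateD → Bool
engaged Out = false
engaged Waiting = true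
engaged Busy = true
engaged AtDoor = false

engaged-sink : ∀ b₁ b₂ x → engaged (sink b₁ b₂ x) ≡ engaged x
engaged-sink b₁ b₂ Out = refl
engaged-sink true b₂ Waiting = refl
engaged-sink false b₂ Waiting = refl
engaged-sink b₁ b₂ Busy = refl
engaged-sink b₁ true AtDoor = refl
engaged-sink b₁ false AtDoor = refl

engaged-resp-sink : ∀ b₁ b₂ {x y} → sink b₁ b₂ x ≡ sink b₁ b₂ y → engaged x ≡ engaged y
engaged-resp-sink b₁ b₂ {x} {y} eq = begin
  engaged x              ≡⟨ sym (engaged-sink b₁ b₂ x) ⟩
  engaged (sink b₁ b₂ x) ≡⟨ cong engaged eq ⟩
  engaged (sink b₁ b₂ y) ≡⟨ engaged-sink b₁ b₂ y ⟩
  engaged y              ∎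
  where open ≡-Reasoning

-- The at?-transitions of CS only depend on whether the client is engaged.
at?-transfer : ∀ {c s c' x} → ClientCSP c (at? s) c' → engaged s ≡ engaged x → Reachable x c →
  ClientCSP c (at? x) c'
at?-transfer it-door _ Interrupt-Out = it-out
at?-transfer it-door () Interrupt-Waiting
at?-transfer it-door _ Interrupt-AtDoor = it-door
at?-transfer it-out _ Interrupt-Out = it-out
at?-transfer it-out () Interrupt-Waiting
at?-transfer it-out _ Interrupt-AtDoor = it-door
at?-transfer it-wait () Interrupt-Out
at?-transfer it-wait _ Interrupt-Waiting = it-wait
at?-transfer it-wait () Interrupt-AtDoor
at?-transfer ht-door () With-Waiting
at?-transfer ht-door () With-Busy
at?-transfer ht-door _ With-AtDoor = ht-door

module _ (b₁ b₂ : Bool) where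
  private
    G = G[ b₁ , b₂ ]
    ⌊_⌋ = sink b₁ b₂

  ∼⇒sink≡ : ∀ {x y} → x ∼[ G ] y → ⌊ x ⌋ ≡ ⌊ y ⌋
  ∼⇒sink≡ (∼-step st g) = GStep-sink b₁ b₂ (_ , st , g)
  ∼⇒sink≡ ∼-refl = refl
  ∼⇒sink≡ (∼-sym p) = sym (∼⇒sink≡ p)
  ∼⇒sink≡ (∼-trans p q) = trans (∼⇒sink≡ p) (∼⇒sink≡ q)

  sink≡⇒∼ : ∀ {x y} → ⌊ x ⌋ ≡ ⌊ y ⌋ → x ∼[ G ] y
  sink≡⇒∼ {x} {y} eq = ∼-trans (Star⇒∼ (to-sink b₁ b₂ x))
    (subst (_∼[ G ] y) (sym eq) (∼-sym (Star⇒∼ (to-sink b₁ b₂ y))))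

  path-to-exit : ∀ {t x₀ a x₀'} → ⌊ t ⌋ ≡ ⌊ x₀ ⌋ → ClientStep x₀ a x₀' → ¬ T (G a) →
    Star (GStep G) t x₀
  path-to-exit {t} eq st ¬g =
    subst (Star (GStep G) t) (trans eq (sink-exit b₁ b₂ st ¬g)) (to-sink b₁ b₂ t)

  SameClass : StateD → StateD → Set
  SameClass y x = ⌊ y ⌋ ≡ ⌊ x ⌋

  quotient-bisim : QuotientVsHiding G
  quotient-bisim = SameClass , (forth , back) , refl
    where
    forth : Transfer τL (QClientLStep G) (HideClientStep G) SameClass
    forth {a = τL} _ ()
    forth {y} {t} {a = lab _} y≈t (¬g , x₀ , x₀' , x₀∼y , x₀'∼y' , st) =
      inj₂ (x₀ , x₀' , path , (st , ¬g) , sym (∼⇒sink≡ x₀'∼y'))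
      where
      path : TauPath τL (HideClientStep G) (SameClass y) t x₀
      path = Star⇒TauPath (λ s → s) (λ s eq → trans eq (GStep-sink b₁ b₂ s)) y≈t
        (path-to-exit (trans (sym y≈t) (sym (∼⇒sink≡ x₀∼y))) st ¬g)
    back : Transfer τL (HideClientStep G) (QClientLStep G) (λ t y → SameClass y t)
    back {t} {y} {t'} {lab _} y≈t (st , ¬g) =
      inj₂ (y , t' , done , (¬g , t , t' , sink≡⇒∼ (sym y≈t) , ∼-refl , st) , refl)
    back {a = τL} y≈t s = inj₁ (refl , trans y≈t (GStep-sink b₁ b₂ s))

  HiddenDG : Steps (StateD × CSState) PAct
  HiddenDG = Hide (InOKG G) (ClientDG G)

  visible : ∀ {p a p'} → ClientDG G p a p' → ¬ InOKG G a → HiddenDG p a p'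
  visible st ¬i = _ , st , inj₂ (¬i , refl)

  data Related : Rel (StateD × CSState) 0ℓ where
    related : ∀ {y x c} → ⌊ y ⌋ ≡ ⌊ x ⌋ → Reachable x c → Related (y , c) (x , c)

  Related⇒Reachable : ∀ {y c x c'} → Related (y , c) (x , c') → Reachable x c'
  Related⇒Reachable (related _ r) = r

  Related-sync : ∀ {p q q'} → HiddenSync G q q' → Related p q → Related p q'
  Related-sync (sync st g q) (related eq r) =
    related (trans eq (GStep-sink b₁ b₂ (_ , st , g))) (Reachable-ok q st r)

  path-to-exit-DG : ∀ {y x c x₀ a x₀' c'} → Related (y , c) (x , c) → x₀ ∼[ G ] y →
    ClientStep x₀ a x₀' → ¬ T (G a) → ClientCSP c (ok! a) c' →
    TauPath τ HiddenDG (Related (y , c)) (x , c) (x₀ , c)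
  path-to-exit-DG {x = x} {x₀ = x₀} y≈x@(related eq _) x₀∼y st ¬g q =
    Star⇒TauPath HiddenSync⇒τ Related-sync y≈x (lift-to-exit b₁ b₂ hidden st q)
    where
    hidden : Star (GStep G) x x₀
    hidden = path-to-exit (trans (sym eq) (sym (∼⇒sink≡ x₀∼y))) st ¬g

  composed-bisim : ComposedVsHiding G
  composed-bisim = Related , (forth , back) , related refl Without-Out
    where
    forth : Transfer τ (QClientDG G) HiddenDG Related
    forth _ (par-l p , ¬h) = ⊥-elim (¬h (QClientP-in-H p))
    forth (related eq r) (par-r q , ¬h) with ClientCSP-¬H⇒trap q ¬h
    ... | _ , refl =
      inj₂ (_ , _ , done , visible (par-r q , ¬h) (λ ()) , related eq (Reachable-trap q r))
    forth (related eq r) (par-c p q cm , _) with orient cm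
    forth _ (par-c () _ _ , _) | inj₁ (o-at _)
    forth {_ , c} {x , _} {_ , c''} (related eq r) (par-c q-at q _ , _) | inj₁ (o-atQ y∼s) =
      inj₂ (_ , _ , done , visible (DG-at q') (λ ()) , related eq (Reachable-at q' r))
      where
      q' : ClientCSP c (at? x) c''
      q' = at?-transfer q (engaged-resp-sink b₁ b₂ (trans (sym (∼⇒sink≡ y∼s)) eq)) r
    forth {y , c} {x , _} y≈x (par-c (q-ok (¬g , x₀ , x₀' , x₀∼y , x₀'∼y' , st)) q _ , _)
      | inj₁ o-ok =
      inj₂ (_ , _ , path , visible (DG-ok st q) ¬g ,
            related (sym (∼⇒sink≡ x₀'∼y')) (Reachable-ok q st r₀))
      where
      path : TauPath τ HiddenDG (Related (y , c)) (x , c) (x₀ , c)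
      path = path-to-exit-DG y≈x x₀∼y st ¬g q
      r₀ : Reachable x₀ c
      r₀ = Related⇒Reachable (TauPath-end path y≈x)
    forth _ (par-c _ () _ , _) | inj₂ (o-at _)
    forth _ (par-c _ () _ , _) | inj₂ (o-atQ _)
    forth _ (par-c _ () _ , _) | inj₂ o-ok
    back : Transfer τ HiddenDG (QClientDG G) (λ x y → Related y x)
    back _ (_ , (par-l p , ¬h) , _) = ⊥-elim (¬h (ClientP-in-H p))
    back (related eq r) (_ , (par-r q , ¬h) , h) with ClientCSP-¬H⇒trap q ¬h | h
    ... | _ , refl | inj₁ (() , _)
    ... | _ , refl | inj₂ (_ , refl) =
      inj₂ (_ , _ , done , (par-r q , ¬h) , related eq (Reachable-trap q r))
    back (related eq r) (_ , (par-c p q cm , _) , h) with orient cm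
    back (related eq r) (_ , (par-c p q _ , _) , h) | inj₁ (o-at _) with ClientP-at-loop p | h
    ... | refl , refl | inj₁ (() , _)
    ... | refl , refl | inj₂ (_ , refl) =
      inj₂ (_ , _ , done , QDG-at (sink≡⇒∼ eq) q , related eq (Reachable-at q r))
    back _ (_ , (par-c () _ _ , _) , _) | inj₁ (o-atQ _)
    back (related eq r) (_ , (par-c p q _ , _) , h) | inj₁ o-ok with ClientCSP-ok!-loop q | h
    ... | refl | inj₁ (g , refl) =
      inj₁ (refl , related (trans eq (GStep-sink b₁ b₂ (_ , st , g))) (Reachable-ok q st r))
      where st = ClientP-ok⇒ClientStep p
    ... | refl | inj₂ (¬g , refl) =
      inj₂ (_ , _ , done , QDG-ok (¬g , _ , _ , sink≡⇒∼ (sym eq) , ∼-refl , st) q ,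
            related refl (Reachable-ok q st r))
      where st = ClientP-ok⇒ClientStep p
    back _ (_ , (par-c _ () _ , _) , _) | inj₂ (o-at _)
    back _ (_ , (par-c _ () _ , _) , _) | inj₂ (o-atQ _)
    back _ (_ , (par-c _ () _ , _) , _) | inj₂ o-ok

lemma1 : (G : Label → Bool) → (∀ a → T (G a) → GloballyInert a) →
    BranchingBisimilar τL (QClientLStep G) Out (HideClientStep G) Out
    × BranchingBisimilar τ (QClientDG G) (Out , Without[triv])
        (Hide (InOKG G) (ClientDG G)) (Out , Without[triv])
lemma1 G inert =
  QuotientVsHiding-resp (G[explain,leave]≗ G inert) (quotient-bisim (G explain) (G leave)) ,
  ComposedVsHiding-resp (G[explain,leave]≗ G inert) (composed-bisim (G explain) (G leave))
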